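{- Let $t\geq 5$ be an integer and let $\Gamma$, $M_1,M_2,M_3$ and $\mathcal{K}$ be as described in the context. Let $K,K'\in\mathcal{K}$ be distinct. Let $L$ be a path of length smaller than $t^{5t-1}$ in $K$ and let $L'$ be a path of length smaller than $t^{5t-1}$ in $K'$ such that $V(L)\cap V(L')\neq\varnothing$. Then either (i) $V(L)\cap V(L')=\{u\}$ for a vertex $u$ that is an end of at least one of $L,L'$, and $V(L)\setminus\{u\}$ and $V(L')\setminus\{u\}$ are anticomplete in $\Gamma$; or (ii) $V(L)\cap V(L')=\{u,v\}$ where $u,v$ are distinct and adjacent in both $L$ and $L'$, and $V(L)\setminus\{u,v\}$ and $V(L')\setminus\{u,v\}$ are anticomplete in $\Gamma$.
   Context: Graphs are finite and simple; the length of a path is its number of edges. Two disjoint vertex sets $X,Y$ are anticomplete in a graph if no edge has one end in $X$ and the other in $Y$. Let $g=t^{5t}$ and let $\Gamma$ be a $3$-regular graph of girth at least $g$ that has a Hamiltonian cycle $\Omega$. Let $(M_1,M_2)$ be a partition of $E(\Omega)$ into two perfect matchings of $\Gamma$, and $M_3=E(\Gamma)\setminus E(\Omega)$. For $i\in\{1,2,3\}$, let $\Gamma_i$ be the spanning subgraph of $\Gamma$ with edge set $E(\Gamma)\setminus M_i$, and $\mathcal{K}_i$ the set of components of $\Gamma_i$ (each is a cycle of $\Gamma$). Let $\mathcal{K}=\mathcal{K}_1\cup\mathcal{K}_2\cup\mathcal{K}_3$. -}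

module Defs where

open import Level using (0ℓ)
open import Data.Nat using (ℕ; zero; suc; _≤_; _<_; _*_; _^_; _∸_)
open import Data.Nat.DivMod using (_mod_)
open import Data.Fin using (Fin; zero; suc; toℕ; inject₁; fromℕ)
open import Data.Product using (Σ; ∃; ∃-syntax; _×_; _,_)
open import Data.Sum using (_⊎_)
open import Relation.Nullary using (¬_)
open import Relation.Unary using (Pred; _∈_; _≐_)
open import Relation.Binary using (Rel; Symmetric)
open import Relation.Binary.PropositionalEquality using (_≡_; _≢_)
open import Relation.Binary.Construct.Closure.ReflexiveTransitive using (Star)
open import Function.Definitions using (Injective; Surjective)
open import Function.Bundles using (_⇔_)

VSet : ℕ → Set₁
VSet n = Pred (Fin n) 0ℓ

ESet : ℕ → Set₁
ESet n = Rel (Fin n) 0ℓ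

record Graph (n : ℕ) : Set₁ where
  field
    Adj    : ESet n
    sym    : Symmetric Adj
    irrefl : ∀ v → ¬ Adj v v
open Graph public

Cubic : ∀ {n} → Graph n → Set
Cubic {n} G = ∀ v → Σ (Fin n) λ a → Σ (Fin n) λ b → Σ (Fin n) λ c →
  a ≢ b × a ≢ c × b ≢ c × Adj G v a × Adj G v b × Adj G v c ×
  (∀ w → Adj G v w → w ≡ a ⊎ w ≡ b ⊎ w ≡ c)

cnext : ∀ {m} → Fin (suc m) → Fin (suc m)
cnext {m} i = suc (toℕ i) mod (suc m)

-- c is a cycle of G of length (suc m): suc m ≥ 3 distinct vertices c 0, …, c m,
-- with c i adjacent to c (i+1 mod (suc m)).
IsCycle : ∀ {n} → Graph n → (m : ℕ) → (Fin (suc m) → Fin n) → Set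
IsCycle G m c = 2 ≤ m × Injective _≡_ _≡_ c × (∀ i → Adj G (c i) (c (cnext i)))

GirthAtLeast : ∀ {n} → Graph n → ℕ → Set
GirthAtLeast G g = ∀ m c → IsCycle G m c → g ≤ suc m

IsHamiltonianCycle : ∀ {n} → Graph n → (m : ℕ) → (Fin (suc m) → Fin n) → Set
IsHamiltonianCycle G m c = IsCycle G m c × Surjective _≡_ _≡_ c

CycleEdges : ∀ {n m} → (Fin (suc m) → Fin n) → ESet n
CycleEdges c u v = ∃[ i ] ((c i ≡ u × c (cnext i) ≡ v) ⊎ (c i ≡ v × c (cnext i) ≡ u))

IsPerfectMatching : ∀ {n} → Graph n → ESet n → Set
IsPerfectMatching {n} G M =
  (∀ u v → M u v → Adj G u v) × Symmetric M ×
  (∀ v → Σ (Fin n) λ u → M v u × (∀ w → M v w → w ≡ u))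

IsPMPartition : ∀ {n} → Graph n → ESet n → ESet n → ESet n → Set
IsPMPartition G F M₁ M₂ =
  IsPerfectMatching G M₁ × IsPerfectMatching G M₂ ×
  (∀ u v → F u v ⇔ (M₁ u v ⊎ M₂ u v)) × (∀ u v → ¬ (M₁ u v × M₂ u v))

Mat : ∀ {n m} → Graph n → (Fin (suc m) → Fin n) → ESet n → ESet n → Fin 3 → ESet n
Mat G ω M₁ M₂ zero = M₁
Mat G ω M₁ M₂ (suc zero) = M₂
Mat G ω M₁ M₂ (suc (suc zero)) u v = Adj G u v × ¬ CycleEdges ω u v

GammaE : ∀ {n m} → Graph n → (Fin (suc m) → Fin n) → ESet n → ESet n → Fin 3 → ESet n
GammaE G ω M₁ M₂ i u v = Adj G u v × ¬ Mat G ω M₁ M₂ i u v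

IsComponent : ∀ {n} → ESet n → VSet n → Set
IsComponent {n} H S =
  (∃[ v ] v ∈ S) ×
  (∀ u v → u ∈ S → v ∈ S → Star (λ x y → H x y × x ∈ S × y ∈ S) u v) ×
  (∀ u v → u ∈ S → H u v → v ∈ S)

CompEdges : ∀ {n} → ESet n → VSet n → ESet n
CompEdges H S u v = H u v × u ∈ S × v ∈ S

SameSubgraph : ∀ {n} → VSet n → ESet n → VSet n → ESet n → Set
SameSubgraph S E S' E' = (S ≐ S') × (∀ u v → E u v ⇔ E' u v)

record PathIn {n} (S : VSet n) (E : ESet n) : Set where
  field
    len   : ℕ
    vtx   : Fin (suc len) → Fin n
    inj   : Injective _≡_ _≡_ vtx
    inS   : ∀ k → vtx k ∈ S
    edges : ∀ (k : Fin len) → E (vtx (inject₁ k)) (vtx (suc k))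
open PathIn public

VP : ∀ {n} {S : VSet n} {E : ESet n} → PathIn S E → VSet n
VP L x = ∃[ k ] vtx L k ≡ x

IsEnd : ∀ {n} {S : VSet n} {E : ESet n} → PathIn S E → Fin n → Set
IsEnd L u = vtx L zero ≡ u ⊎ vtx L (fromℕ (len L)) ≡ u

AdjIn : ∀ {n} {S : VSet n} {E : ESet n} → PathIn S E → Fin n → Fin n → Set
AdjIn L u v = ∃[ k ] ((vtx L (inject₁ k) ≡ u × vtx L (suc k) ≡ v)
                     ⊎ (vtx L (inject₁ k) ≡ v × vtx L (suc k) ≡ u))

Anticomplete : ∀ {n} → Graph n → VSet n → VSet n → Set
Anticomplete G X Y = ∀ x y → x ∈ X → y ∈ Y → ¬ Adj G x y

-- The two paths have fewer than t^(5t) vertices together, so any cycle made of a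
-- segment of L, a segment of L′ and at most two further edges of Γ is shorter than the girth,
-- which is impossible. Applied to the part of L between two successive common vertices, this
-- shows that successive common vertices are adjacent on both paths. Three common vertices
-- would then give a vertex with two neighbours joined to it by edges of both Γᵢ and Γⱼ, whereas
-- Γᵢ ∩ Γⱼ is the perfect matching Mₖ; so the paths meet in a vertex or in an edge. A single
-- common vertex inside both paths would have four neighbours in the cubic graph Γ, and an edge
-- of Γ between the two paths outside the common part closes a short cycle through the common
-- vertices nearest to its ends. Finally, if i = j the two components share a vertex, so K = K′.
module Submission where

open import Level using (0ℓ)
open import Defs hiding (sym)
open import Data.Nat
open import Data.Nat.Properties
open import Data.Nat.DivMod using (_mod_; m%n<n; m≤n⇒m%n≡m; n%n≡0)
open import Data.Fin as F using (Fin; zero; suc; toℕ; fromℕ; fromℕ<; inject₁)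
open import Data.Fin.Properties
  using (toℕ-injective; toℕ-fromℕ; toℕ-fromℕ<; toℕ-inject₁; toℕ≤pred[n]; injective⇒≤)
open import Data.List as List using (List; []; _∷_; _++_; map; length)
open import Data.List.Properties using (length-++; length-map)
open import Data.List.Relation.Unary.All as All using (All; []; _∷_)
open import Data.List.Relation.Unary.All.Properties using () renaming (map⁺ to All-map⁺)
open import Data.List.Relation.Unary.Any as Any using (here; there)
open import Data.List.Relation.Unary.Any.Properties using (lookup-index)
open import Data.List.Relation.Unary.AllPairs using ([]; _∷_)
open import Data.List.Relation.Unary.Unique.Propositional using (Unique)
open import Data.List.Relation.Unary.Unique.Propositional.Properties using () renaming (++⁺ to Unique-++⁺)
open import Data.List.Membership.Propositional using () renaming (_∈_ to _∈ₗ_)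
open import Data.List.Membership.Propositional.Properties using (∈-lookup; ∈-map⁻)
open import Data.Vec as Vec using (Vec)
import Data.Vec.Relation.Unary.All as VecAll
open import Data.Vec.Relation.Unary.All using ([]; _∷_)
open import Data.Vec.Relation.Unary.All.Properties using (lookup⁺)
open import Data.Vec.Relation.Unary.AllPairs using ([]; _∷_)
import Data.Vec.Relation.Unary.Unique.Propositional as VecUnique
open import Data.Vec.Relation.Unary.Unique.Propositional.Properties
  using () renaming (lookup-injective to Vec-lookup-injective)
open import Data.Product as Product using (∃; ∃-syntax; _×_; _,_; proj₁; proj₂)
open import Data.Sum as Sum using (_⊎_; inj₁; inj₂)
open import Data.Empty using (⊥; ⊥-elim)
open import Function using (_∘_)
open import Function.Bundles using (_⇔_; mk⇔; Equivalence)
open import Relation.Nullary using (¬_; Dec; yes; no; _×-dec_)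
open import Relation.Nullary.Decidable using (decidable-stable)
open import Relation.Unary using (_∈_; Decidable)
open import Relation.Binary using (Rel; Symmetric; _⇒_; tri<; tri≈; tri>)
open import Relation.Binary.PropositionalEquality
open import Relation.Binary.Construct.Closure.ReflexiveTransitive using (Star; ε; _◅_)

-- Walks and cycles

data Walk {A : Set} (R : Rel A 0ℓ) : A → A → List A → Set where
  [_]ʷ : ∀ x → Walk R x x (x ∷ [])
  _∷ʷ_ : ∀ {x y z ys} → R x y → Walk R y z (y ∷ ys) → Walk R x z (x ∷ y ∷ ys)

module _ {A : Set} {R : Rel A 0ℓ} where

  _◅ʷ_ : ∀ {x y z ys} → R x y → Walk R y z ys → Walk R x z (x ∷ ys)
  r ◅ʷ w@([ _ ]ʷ) = r ∷ʷ w
  r ◅ʷ w@(_ ∷ʷ _) = r ∷ʷ w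

  walk-++ : ∀ {x y y′ z xs ys} → Walk R x y xs → R y y′ → Walk R y′ z ys → Walk R x z (xs ++ ys)
  walk-++ [ _ ]ʷ      r w = r ◅ʷ w
  walk-++ (r′ ∷ʷ w′) r w = r′ ∷ʷ walk-++ w′ r w

  walk-lookup : ∀ {x y C} → Walk R x y C → (i j : Fin (length C)) →
                toℕ j ≡ suc (toℕ i) → R (List.lookup C i) (List.lookup C j)
  walk-lookup [ _ ]ʷ   zero    zero       ()
  walk-lookup (r ∷ʷ w) zero    zero       ()
  walk-lookup (r ∷ʷ w) zero    (suc zero) refl = r
  walk-lookup (r ∷ʷ w) (suc i) zero       ()
  walk-lookup (r ∷ʷ w) (suc i) (suc j)    eq   = walk-lookup w i j (suc-injective eq)

  walk-head : ∀ {x y c C} → Walk R x y (c ∷ C) → c ≡ x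
  walk-head [ _ ]ʷ   = refl
  walk-head (_ ∷ʷ _) = refl

  walk-last : ∀ {x y c C} → Walk R x y (c ∷ C) → List.lookup (c ∷ C) (fromℕ (length C)) ≡ y
  walk-last [ _ ]ʷ   = refl
  walk-last (_ ∷ʷ w) = walk-last w

module _ {A B : Set} {R : Rel A 0ℓ} {R′ : Rel B 0ℓ} {P : A → Set} (f : A → B) where

  walk-map : (∀ {k l} → P k → P l → R k l → R′ (f k) (f l)) →
             ∀ {x y xs} → All P xs → Walk R x y xs → Walk R′ (f x) (f y) (map f xs)
  walk-map f-hom (_ ∷ [])             [ x ]ʷ   = [ f x ]ʷ
  walk-map f-hom (px ∷ pxs@(py ∷ _)) (r ∷ʷ w) = f-hom px py r ∷ʷ walk-map f-hom pxs w

module _ {A B : Set} {P : A → Set} (f : A → B) where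

  Unique-map⁺-on : (∀ {k l} → P k → P l → f k ≡ f l → k ≡ l) →
                   ∀ {xs} → All P xs → Unique xs → Unique (map f xs)
  Unique-map⁺-on f-inj []         []          = []
  Unique-map⁺-on f-inj (px ∷ pxs) (x∉ ∷ uxs) =
    All-map⁺ (All.zipWith (λ (py , x≢y) fx≡fy → x≢y (f-inj px py fx≡fy)) (pxs , x∉))
    ∷ Unique-map⁺-on f-inj pxs uxs

lookup-injective : ∀ {A : Set} {xs : List A} → Unique xs →
                   ∀ {i j} → List.lookup xs i ≡ List.lookup xs j → i ≡ j
lookup-injective (x∉ ∷ _)  {zero}  {zero}  _  = refl
lookup-injective (x∉ ∷ _)  {zero}  {suc j} eq = ⊥-elim (All.lookup x∉ (∈-lookup j) eq)
lookup-injective (x∉ ∷ _)  {suc i} {zero}  eq = ⊥-elim (All.lookup x∉ (∈-lookup i) (sym eq))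
lookup-injective (_ ∷ uxs) {suc i} {suc j} eq = cong suc (lookup-injective uxs eq)

pigeonhole-⊆ : ∀ {A : Set} {k} {ws : Vec A k} {us : List A} →
               VecUnique.Unique ws → VecAll.All (_∈ₗ us) ws → k ≤ length us
pigeonhole-⊆ {ws = ws} {us} distinct ws⊆us = injective⇒≤ same-position⇒same-index
  where
  position : ∀ i → Vec.lookup ws i ≡ List.lookup us (Any.index (lookup⁺ ws⊆us i))
  position i = lookup-index (lookup⁺ ws⊆us i)

  same-position⇒same-index : ∀ {i j} → Any.index (lookup⁺ ws⊆us i) ≡ Any.index (lookup⁺ ws⊆us j) → i ≡ j
  same-position⇒same-index {i} {j} eq = Vec-lookup-injective distinct i j
    (trans (position i) (trans (cong (List.lookup us) eq) (sym (position j))))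

toℕ-cnext : ∀ {m} (i : Fin (suc m)) → toℕ (cnext i) ≡ suc (toℕ i) % suc m
toℕ-cnext {m} i = toℕ-fromℕ< (m%n<n (suc (toℕ i)) (suc m))

girth≤cycle-length : ∀ {n} {Γ : Graph n} {g} → GirthAtLeast Γ g →
                     ∀ {x y C} → Walk (Adj Γ) x y C → Adj Γ y x → Unique C → 3 ≤ length C → g ≤ length C
girth≤cycle-length {Γ = Γ} girth {x} {y} {c ∷ C} w yx distinct (s≤s 2≤m) =
  girth (length C) (List.lookup (c ∷ C)) (2≤m , lookup-injective distinct , closes)
  where
  closes : ∀ i → Adj Γ (List.lookup (c ∷ C) i) (List.lookup (c ∷ C) (cnext i))
  closes i with m≤n⇒m<n∨m≡n (toℕ≤pred[n] i)
  ... | inj₁ i<m = walk-lookup w i (cnext i) (trans (toℕ-cnext i) (m≤n⇒m%n≡m i<m))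
  ... | inj₂ i≡m = subst₂ (Adj Γ) (sym (trans (cong (List.lookup (c ∷ C)) i≡last) (walk-last w)))
                                   (sym (trans (cong (List.lookup (c ∷ C)) next≡0) (walk-head w))) yx
    where
    i≡last : i ≡ fromℕ (length C)
    i≡last = toℕ-injective (trans i≡m (sym (toℕ-fromℕ (length C))))

    next≡0 : cnext i ≡ zero
    next≡0 = toℕ-injective (trans (toℕ-cnext i)
               (trans (cong (λ k → suc k % suc (length C)) i≡m) (n%n≡0 (suc (length C)))))

-- Index intervals

Between : ℕ → ℕ → ℕ → Set
Between s e k = (s ≤ k × k ≤ e) ⊎ (e ≤ k × k ≤ s)

Consecutive : ℕ → ℕ → Set
Consecutive k l = suc k ≡ l ⊎ suc l ≡ k

between-swap : ∀ {s e k} → Between s e k → Between e s k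
between-swap (inj₁ b) = inj₂ b
between-swap (inj₂ b) = inj₁ b

between-start : ∀ s e → Between s e s
between-start s e with ≤-total s e
... | inj₁ s≤e = inj₁ (≤-refl , s≤e)
... | inj₂ e≤s = inj₂ (e≤s , ≤-refl)

between-≤ : ∀ {s e k b} → s ≤ b → e ≤ b → Between s e k → k ≤ b
between-≤ s≤b e≤b (inj₁ (_ , k≤e)) = ≤-trans k≤e e≤b
between-≤ s≤b e≤b (inj₂ (_ , k≤s)) = ≤-trans k≤s s≤b

between-ordered : ∀ {s e k} → s ≤ e → Between s e k → s ≤ k × k ≤ e
between-ordered s≤e (inj₁ b)           = b
between-ordered s≤e (inj₂ (e≤k , k≤s)) = ≤-trans s≤e e≤k , ≤-trans k≤s s≤e

consecutive-sym : ∀ {k l} → Consecutive k l → Consecutive l k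
consecutive-sym (inj₁ eq) = inj₂ eq
consecutive-sym (inj₂ eq) = inj₁ eq

m≤n⇒∣m-1+n∣≡1+∣m-n∣ : ∀ {m n} → m ≤ n → ∣ m - suc n ∣ ≡ suc ∣ m - n ∣
m≤n⇒∣m-1+n∣≡1+∣m-n∣ z≤n       = refl
m≤n⇒∣m-1+n∣≡1+∣m-n∣ (s≤s m≤n) = m≤n⇒∣m-1+n∣≡1+∣m-n∣ m≤n

record StepToward (s e : ℕ) : Set where
  field
    next        : ℕ
    consecutive : Consecutive s next
    closer      : suc ∣ next - e ∣ ≡ ∣ s - e ∣
    narrower    : ∀ {k} → Between next e k → Between s e k × k ≢ s

step-toward : ∀ {s e} → s ≢ e → StepToward s e
step-toward {s} {e} s≢e with <-cmp s e
... | tri≈ _ s≡e _ = ⊥-elim (s≢e s≡e)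
... | tri< s<e@(s≤s {n = e′} s≤e′) _ _ = record
  { next        = suc s
  ; consecutive = inj₁ refl
  ; closer      = sym (m≤n⇒∣m-1+n∣≡1+∣m-n∣ s≤e′)
  ; narrower    = λ b → let (s<k , k≤e) = between-ordered s<e b in
                        inj₁ (<⇒≤ s<k , k≤e) , >⇒≢ s<k
  }
... | tri> _ _ e<s@(s≤s {n = s′} e≤s′) = record
  { next        = s′
  ; consecutive = inj₂ refl
  ; closer      = trans (cong suc (∣-∣-comm s′ e)) (trans (sym (m≤n⇒∣m-1+n∣≡1+∣m-n∣ e≤s′)) (∣-∣-comm e s))
  ; narrower    = λ b → let (e≤k , k≤s′) = between-ordered e≤s′ (between-swap b) in
                        inj₂ (e≤k , m≤n⇒m≤1+n k≤s′) , <⇒≢ (s≤s k≤s′)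
  }

record Segment (s e : ℕ) : Set where
  field
    indices : List ℕ
    walk    : Walk Consecutive s e indices
    unique  : Unique indices
    within  : All (Between s e) indices
    length≡ : length indices ≡ suc ∣ s - e ∣

  length≤ : ∀ {b} → s ≤ b → e ≤ b → length indices ≤ suc b
  length≤ {b} s≤b e≤b = subst (_≤ suc b) (sym length≡) (s≤s (≤-trans (∣m-n∣≤m⊔n s e) (⊔-lub s≤b e≤b)))

  length≥1 : 1 ≤ length indices
  length≥1 = subst (1 ≤_) (sym length≡) (s≤s z≤n)

  length≥2 : s ≢ e → 2 ≤ length indices
  length≥2 s≢e = subst (2 ≤_) (sym length≡) (s≤s (n≢0⇒n>0 (s≢e ∘ ∣m-n∣≡0⇒m≡n)))

segment : ∀ s e → Segment s e
segment s e = from-distance ∣ s - e ∣ refl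
  where
  from-distance : ∀ d {s} → ∣ s - e ∣ ≡ d → Segment s e
  from-distance zero {s} d≡0 with ∣m-n∣≡0⇒m≡n {s} {e} d≡0
  ... | refl = record
    { indices = s ∷ []
    ; walk    = [ s ]ʷ
    ; unique  = [] ∷ []
    ; within  = between-start s s ∷ []
    ; length≡ = cong suc (sym d≡0)
    }
  from-distance (suc d) {s} d≡1+d = record
    { indices = s ∷ indices
    ; walk    = consecutive ◅ʷ walk
    ; unique  = All.map (λ b → ≢-sym (proj₂ (narrower b))) within ∷ unique
    ; within  = between-start s e ∷ All.map (proj₁ ∘ narrower) within
    ; length≡ = cong suc (trans length≡ closer)
    }
    where
    s≢e : s ≢ e
    s≢e refl = 0≢1+n (trans (sym (m≡n⇒∣m-n∣≡0 {s} refl)) d≡1+d)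

    open StepToward (step-toward s≢e)
    open Segment (from-distance d {next} (suc-injective (trans closer d≡1+d)))

module _ {J : ℕ → Set} (J? : Decidable J) where

  private
    least-from : ∀ d s → J (s + d) →
                 ∃ λ m → s ≤ m × m ≤ s + d × J m × (∀ {m′} → s ≤ m′ → m′ < m → ¬ J m′)
    least-from d s J[s+d] with J? s
    ... | yes Js = s , ≤-refl , m≤m+n s d , Js , λ s≤m′ m′<s _ → <⇒≱ m′<s s≤m′
    least-from zero s J[s+0] | no ¬Js = ⊥-elim (¬Js (subst J (+-identityʳ s) J[s+0]))
    least-from (suc d) s J[s+1+d] | no ¬Js with least-from d (suc s) (subst J (+-suc s d) J[s+1+d])
    ... | m , s<m , m≤ , Jm , below = m , <⇒≤ s<m , ≤-trans m≤ (≤-reflexive (sym (+-suc s d))) , Jm , skip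
      where
      skip : ∀ {m′} → s ≤ m′ → m′ < m → ¬ J m′
      skip s≤m′ m′<m with m≤n⇒m<n∨m≡n s≤m′
      ... | inj₁ s<m′ = below s<m′ m′<m
      ... | inj₂ refl = ¬Js

    greatest-from : ∀ d s → J s →
                    ∃ λ m → s ≤ m × m ≤ s + d × J m × (∀ {m′} → m < m′ → m′ ≤ s + d → ¬ J m′)
    greatest-from zero s Js =
      s , ≤-refl , m≤m+n s 0 , Js , λ s<m′ m′≤s+0 _ → <⇒≱ s<m′ (≤-trans m′≤s+0 (≤-reflexive (+-identityʳ s)))
    greatest-from (suc d) s Js with J? (s + suc d)
    ... | yes Jtop = s + suc d , m≤m+n s (suc d) , ≤-refl , Jtop , λ top<m′ m′≤top _ → <⇒≱ top<m′ m′≤top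
    ... | no ¬Jtop with greatest-from d s Js
    ...   | m , s≤m , m≤ , Jm , above = m , s≤m , ≤-trans m≤ (+-monoʳ-≤ s (n≤1+n d)) , Jm , skip
      where
      skip : ∀ {m′} → m < m′ → m′ ≤ s + suc d → ¬ J m′
      skip {m′} m<m′ m′≤top with m≤n⇒m<n∨m≡n m′≤top
      ... | inj₁ m′<top = above m<m′ (≤-pred (subst (m′ <_) (+-suc s d) m′<top))
      ... | inj₂ refl   = ¬Jtop

  nearest : ∀ k {i} → J i → ∃ λ m → J m × Between k i m × (∀ {m′} → Between k m m′ → J m′ → m′ ≡ m)
  nearest k {i} Ji with ≤-total k i
  ... | inj₁ k≤i with least-from (i ∸ k) k (subst J (sym (m+[n∸m]≡n k≤i)) Ji)
  ...   | m , k≤m , m≤ , Jm , below = m , Jm , inj₁ (k≤m , subst (m ≤_) (m+[n∸m]≡n k≤i) m≤) , closest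
    where
    closest : ∀ {m′} → Between k m m′ → J m′ → m′ ≡ m
    closest b Jm′ with between-ordered k≤m b
    ... | k≤m′ , m′≤m with m≤n⇒m<n∨m≡n m′≤m
    ...   | inj₁ m′<m = ⊥-elim (below k≤m′ m′<m Jm′)
    ...   | inj₂ m′≡m = m′≡m
  nearest k {i} Ji | inj₂ i≤k with greatest-from (k ∸ i) i Ji
  ... | m , i≤m , m≤ , Jm , above = m , Jm , inj₂ (i≤m , m≤k) , closest
    where
    m≤k : m ≤ k
    m≤k = subst (m ≤_) (m+[n∸m]≡n i≤k) m≤

    closest : ∀ {m′} → Between k m m′ → J m′ → m′ ≡ m
    closest b Jm′ with between-ordered m≤k (between-swap b)
    ... | m≤m′ , m′≤k with m≤n⇒m<n∨m≡n m≤m′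
    ...   | inj₁ m<m′ = ⊥-elim (above m<m′ (subst (_ ≤_) (sym (m+[n∸m]≡n i≤k)) m′≤k) Jm′)
    ...   | inj₂ m≡m′ = sym m≡m′

-- Paths and the cycles they span

-- The vertices are at 0, …, at last; the values of at beyond last play no role.
record Path {n} (R : ESet n) : Set where
  field
    last         : ℕ
    at           : ℕ → Fin n
    at-injective : ∀ {k l} → k ≤ last → l ≤ last → at k ≡ at l → k ≡ l
    at-step      : ∀ {k} → k < last → R (at k) (at (suc k))

  Vert : VSet n
  Vert x = ∃ λ k → k ≤ last × at k ≡ x

  IsEndpoint : VSet n
  IsEndpoint u = at 0 ≡ u ⊎ at last ≡ u

  HasEdge : ESet n
  HasEdge u v = ∃ λ k → k < last × ((at k ≡ u × at (suc k) ≡ v) ⊎ (at k ≡ v × at (suc k) ≡ u))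

  Vert? : Decidable Vert
  Vert? x with anyUpTo? (λ k → at k F.≟ x) (suc last)
  ... | yes (k , s≤s k≤last , eq) = yes (k , k≤last , eq)
  ... | no none                   = no λ (k , k≤last , eq) → none (k , s≤s k≤last , eq)

  at-consecutive : Symmetric R → ∀ {k l} → k ≤ last → l ≤ last → Consecutive k l → R (at k) (at l)
  at-consecutive R-sym _      l≤last (inj₁ refl) = at-step l≤last
  at-consecutive R-sym k≤last _      (inj₂ refl) = R-sym (at-step k≤last)

  weaken : ∀ {R′ : ESet n} → R ⇒ R′ → Path R′
  weaken R⇒R′ = record { last = last ; at = at ; at-injective = at-injective ; at-step = R⇒R′ ∘ at-step }

  module _ (R-sym : Symmetric R) {s e} (σ : Segment s e) (s≤last : s ≤ last) (e≤last : e ≤ last) where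
    open Segment σ

    private
      bounded : All (_≤ last) indices
      bounded = All.map (between-≤ s≤last e≤last) within

    segment-walk : Walk R (at s) (at e) (map at indices)
    segment-walk = walk-map at (λ k≤ l≤ → at-consecutive R-sym k≤ l≤) bounded walk

    segment-unique : Unique (map at indices)
    segment-unique = Unique-map⁺-on at at-injective bounded unique

open Path using (last; at; at-injective; at-step; Vert; Vert?; IsEndpoint; HasEdge; at-consecutive)

module _ {n} {Γ : Graph n} {g} (girth : GirthAtLeast Γ g)
         (P Q : Path (Adj Γ)) (short : suc (last P) + suc (last Q) < g) where

  no-cycle-through-segments :
    ∀ {s e s′ e′} → s ≤ last P → e ≤ last P → s′ ≤ last Q → e′ ≤ last Q → s ≢ e →
    Adj Γ (at P e) (at Q s′) → Adj Γ (at Q e′) (at P s) →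
    (∀ {k l} → Between s e k → Between s′ e′ l → at P k ≢ at Q l) → ⊥
  no-cycle-through-segments {s} {e} {s′} {e′} s≤ e≤ s′≤ e′≤ s≢e join join′ disjoint =
    <⇒≱ short (≤-trans (girth≤cycle-length {Γ = Γ} girth walk join′ unique three) bounded)
    where
    σ : Segment s e
    σ = segment s e

    τ : Segment s′ e′
    τ = segment s′ e′

    module σ = Segment σ
    module τ = Segment τ

    C : List (Fin n)
    C = map (at P) σ.indices ++ map (at Q) τ.indices

    walk : Walk (Adj Γ) (at P s) (at Q e′) C
    walk = walk-++ (Path.segment-walk P (Graph.sym Γ) σ s≤ e≤) join
                   (Path.segment-walk Q (Graph.sym Γ) τ s′≤ e′≤)

    apart : ∀ {v} → ¬ (v ∈ₗ map (at P) σ.indices × v ∈ₗ map (at Q) τ.indices)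
    apart (v∈σ , v∈τ) with ∈-map⁻ (at P) v∈σ | ∈-map⁻ (at Q) v∈τ
    ... | k , k∈σ , v≡Pk | l , l∈τ , v≡Ql =
      disjoint (All.lookup σ.within k∈σ) (All.lookup τ.within l∈τ) (trans (sym v≡Pk) v≡Ql)

    unique : Unique C
    unique = Unique-++⁺ (Path.segment-unique P (Graph.sym Γ) σ s≤ e≤)
                        (Path.segment-unique Q (Graph.sym Γ) τ s′≤ e′≤) apart

    length-C : length C ≡ length σ.indices + length τ.indices
    length-C = trans (length-++ (map (at P) σ.indices))
                     (cong₂ _+_ (length-map (at P) σ.indices) (length-map (at Q) τ.indices))

    three : 3 ≤ length C
    three = subst (3 ≤_) (sym length-C) (+-mono-≤ (σ.length≥2 s≢e) τ.length≥1)

    bounded : length C ≤ suc (last P) + suc (last Q)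
    bounded = subst (_≤ _) (sym length-C) (+-mono-≤ (σ.length≤ s≤ e≤) (τ.length≤ s′≤ e′≤))

  -- The cycle runs along P from k to i, then along Q from j (from the step after j when the two
  -- ends coincide) to l, and back to k.
  no-closing-edge :
    ∀ {k i j l} → k ≤ last P → i ≤ last P → j ≤ last Q → l ≤ last Q → k ≢ i → l ≢ j →
    at P i ≡ at Q j ⊎ Adj Γ (at P i) (at Q j) →
    (∀ {k′ l′} → Between k i k′ → Between l j l′ → at P k′ ≡ at Q l′ → k′ ≡ i × l′ ≡ j) →
    ¬ Adj Γ (at P k) (at Q l)
  no-closing-edge {k} {i} {j} {l} k≤ i≤ j≤ l≤ k≢i l≢j (inj₁ same) only-ends kl =
    no-cycle-through-segments k≤ i≤ next≤ l≤ k≢i join (Graph.sym Γ kl) disjoint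
    where
    open StepToward (step-toward (≢-sym l≢j))

    next≤ : next ≤ last Q
    next≤ = between-≤ j≤ l≤ (proj₁ (narrower (between-start next l)))

    join : Adj Γ (at P i) (at Q next)
    join = subst (λ v → Adj Γ v (at Q next)) (sym same) (at-consecutive Q (Graph.sym Γ) j≤ next≤ consecutive)

    disjoint : ∀ {k′ l′} → Between k i k′ → Between next l l′ → at P k′ ≢ at Q l′
    disjoint bk bl eq = proj₂ (narrower bl) (proj₂ (only-ends bk (between-swap (proj₁ (narrower bl))) eq))
  no-closing-edge {k} {i} {j} {l} k≤ i≤ j≤ l≤ k≢i l≢j (inj₂ adj) only-ends kl =
    no-cycle-through-segments k≤ i≤ j≤ l≤ k≢i adj (Graph.sym Γ kl) disjoint
    where
    disjoint : ∀ {k′ l′} → Between k i k′ → Between j l l′ → at P k′ ≢ at Q l′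
    disjoint bk bl eq with only-ends bk (between-swap bl) eq
    ... | refl , refl = Graph.irrefl Γ (at P i) (subst (Adj Γ (at P i)) (sym eq) adj)

neighbours≤3 : ∀ {n} {Γ : Graph n} → Cubic Γ → ∀ {v k} {ws : Vec (Fin n) k} →
               VecUnique.Unique ws → VecAll.All (Adj Γ v) ws → k ≤ 3
neighbours≤3 {Γ = Γ} cubic {v} distinct adjacent with cubic v
... | a , b , c , _ , _ , _ , _ , _ , _ , only = pigeonhole-⊆ distinct (VecAll.map listed adjacent)
  where
  listed : ∀ {w} → Adj Γ v w → w ∈ₗ a ∷ b ∷ c ∷ []
  listed vw with only _ vw
  ... | inj₁ w≡a        = here w≡a
  ... | inj₂ (inj₁ w≡b) = there (here w≡b)
  ... | inj₂ (inj₂ w≡c) = there (there (here w≡c))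

-- How two paths meet

module _ {n} (Γ : Graph n) (X Y : VSet n) where

  SingleMeeting : (EndX EndY : VSet n) → Set
  SingleMeeting EndX EndY =
    ∃[ u ] ((∀ x → (x ∈ X × x ∈ Y) ⇔ (x ≡ u)) ×
            (EndX u ⊎ EndY u) ×
            Anticomplete Γ (λ x → x ∈ X × x ≢ u) (λ x → x ∈ Y × x ≢ u))

  DoubleMeeting : (EdgeX EdgeY : ESet n) → Set
  DoubleMeeting EdgeX EdgeY =
    ∃[ u ] ∃[ v ] (u ≢ v ×
            (∀ x → (x ∈ X × x ∈ Y) ⇔ (x ≡ u ⊎ x ≡ v)) ×
            EdgeX u v × EdgeY u v ×
            Anticomplete Γ (λ x → x ∈ X × x ≢ u × x ≢ v) (λ x → x ∈ Y × x ≢ u × x ≢ v))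

  MeetingShape : (EndX EndY : VSet n) (EdgeX EdgeY : ESet n) → Set
  MeetingShape EndX EndY EdgeX EdgeY = SingleMeeting EndX EndY ⊎ DoubleMeeting EdgeX EdgeY

module _ {n} {Γ : Graph n} {X X′ Y Y′ : VSet n} (X⇔X′ : ∀ x → X x ⇔ X′ x) (Y⇔Y′ : ∀ y → Y y ⇔ Y′ y) where

  private
    from-X : ∀ {x} → X′ x → X x
    from-X = Equivalence.from (X⇔X′ _)

    from-Y : ∀ {y} → Y′ y → Y y
    from-Y = Equivalence.from (Y⇔Y′ _)

    common-transport : ∀ {Z : Set} x → (x ∈ X × x ∈ Y) ⇔ Z → (x ∈ X′ × x ∈ Y′) ⇔ Z
    common-transport x common =
      mk⇔ (λ (x∈X′ , x∈Y′) → Equivalence.to common (from-X x∈X′ , from-Y x∈Y′))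
          (Product.map (Equivalence.to (X⇔X′ x)) (Equivalence.to (Y⇔Y′ x)) ∘ Equivalence.from common)

  MeetingShape-transport :
    ∀ {EX EX′ EY EY′ : VSet n} {FX FX′ FY FY′ : ESet n} →
    (∀ {u} → EX u → EX′ u) → (∀ {u} → EY u → EY′ u) →
    (∀ {u v} → FX u v → FX′ u v) → (∀ {u v} → FY u v → FY′ u v) →
    MeetingShape Γ X Y EX EY FX FY → MeetingShape Γ X′ Y′ EX′ EY′ FX′ FY′
  MeetingShape-transport EX⇒ EY⇒ _ _ (inj₁ (u , common , end , anti)) =
    inj₁ (u , (λ x → common-transport x (common x)) , Sum.map EX⇒ EY⇒ end ,
          λ x y (x∈ , x≢) (y∈ , y≢) → anti x y (from-X x∈ , x≢) (from-Y y∈ , y≢))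
  MeetingShape-transport _ _ FX⇒ FY⇒ (inj₂ (u , v , u≢v , common , edgeX , edgeY , anti)) =
    inj₂ (u , v , u≢v , (λ x → common-transport x (common x)) , FX⇒ edgeX , FY⇒ edgeY ,
          λ x y (x∈ , x≢) (y∈ , y≢) → anti x y (from-X x∈ , x≢) (from-Y y∈ , y≢))

module Meetings {n} {Γ : Graph n} (cubic : Cubic Γ) {g} (girth : GirthAtLeast Γ g)
  {E E′ : ESet n} (E⇒Γ : E ⇒ Adj Γ) (E′⇒Γ : E′ ⇒ Adj Γ) (E-sym : Symmetric E) (E′-sym : Symmetric E′)
  (shared-edge-functional : ∀ {x y z} → E x y → E′ x y → E x z → E′ x z → y ≡ z)
  (P : Path E) (Q : Path E′) (short : suc (last P) + suc (last Q) < g) where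

  private
    p q : ℕ
    p = last P
    q = last Q

    a b : ℕ → Fin n
    a = at P
    b = at Q

    P̂ : Path (Adj Γ)
    P̂ = Path.weaken P E⇒Γ

    Q̂ : Path (Adj Γ)
    Q̂ = Path.weaken Q E′⇒Γ

    short′ : suc q + suc p < g
    short′ = subst (_< g) (+-comm (suc p) (suc q)) short

  Common : VSet n
  Common x = Vert P x × Vert Q x

  MeetsQ : ℕ → Set
  MeetsQ k = Vert Q (a k)

  MeetsQ? : Decidable MeetsQ
  MeetsQ? k = Vert? Q (a k)

  MeetsP? : Decidable (λ l → Vert P (b l))
  MeetsP? l = Vert? P (b l)

  next-meeting-is-successor : ∀ {i i′} → i < i′ → i′ ≤ p → MeetsQ i → MeetsQ i′ →
                              (∀ {k} → i < k → k < i′ → ¬ MeetsQ k) → i′ ≡ suc i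
  next-meeting-is-successor {i} {suc i″} (s≤s i≤i″) i′≤p (j , j≤q , bj≡ai) (j′ , j′≤q , bj′≡ai′) gap
    with i″ ≟ i
  ... | yes refl = refl
  ... | no i″≢i = ⊥-elim (no-closing-edge {Γ = Γ} girth P̂ Q̂ short (<⇒≤ i′≤p) i≤p j≤q j′≤q i″≢i j′≢j
                                          (inj₁ (sym bj≡ai)) only-ends last-edge)
    where
    i≤p : i ≤ p
    i≤p = ≤-trans i≤i″ (<⇒≤ i′≤p)

    j′≢j : j′ ≢ j
    j′≢j refl = <-irrefl (at-injective P i≤p i′≤p (trans (sym bj≡ai) bj′≡ai′)) (s≤s i≤i″)

    last-edge : Adj Γ (a i″) (b j′)
    last-edge = subst (Adj Γ (a i″)) (sym bj′≡ai′) (E⇒Γ (at-step P i′≤p))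

    only-ends : ∀ {k l} → Between i″ i k → Between j′ j l → a k ≡ b l → k ≡ i × l ≡ j
    only-ends {k} {l} bk bl ak≡bl with between-ordered i≤i″ (between-swap bk)
    ... | i≤k , k≤i″ with m≤n⇒m<n∨m≡n i≤k
    ...   | inj₁ i<k  = ⊥-elim (gap i<k (s≤s k≤i″) (l , between-≤ j′≤q j≤q bl , sym ak≡bl))
    ...   | inj₂ refl = refl , at-injective Q (between-≤ j′≤q j≤q bl) j≤q (trans (sym ak≡bl) (sym bj≡ai))

  -- Otherwise the first step of Q from j′ towards j, followed by the edge a (suc i) a i, closes a short cycle.
  shared-edge-consecutive : ∀ {i j j′} → suc i ≤ p → j ≤ q → j′ ≤ q →
                            b j ≡ a i → b j′ ≡ a (suc i) → Consecutive j j′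
  shared-edge-consecutive {i} {j} {j′} i<p j≤q j′≤q bj≡ai bj′≡ai′ = conclude (next ≟ j)
    where
    j′≢j : j′ ≢ j
    j′≢j refl = 1+n≢n (sym (at-injective P (<⇒≤ i<p) i<p (trans (sym bj≡ai) bj′≡ai′)))

    open StepToward (step-toward j′≢j)

    next≤q : next ≤ q
    next≤q = between-≤ j′≤q j≤q (proj₁ (narrower (between-start next j)))

    first-edge : Adj Γ (b next) (a (suc i))
    first-edge = subst (Adj Γ (b next)) bj′≡ai′
                   (at-consecutive Q̂ (Graph.sym Γ) next≤q j′≤q (consecutive-sym consecutive))

    only-ends : ∀ {k l} → Between next j k → Between (suc i) i l → b k ≡ a l → k ≡ j × l ≡ i
    only-ends {k} {l} bk bl bk≡al with between-ordered (n≤1+n i) (between-swap bl)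
    ... | i≤l , l≤1+i with m≤n⇒m<n∨m≡n l≤1+i
    ...   | inj₁ l<1+i = at-injective Q k≤q j≤q (trans bk≡al (trans (cong a l≡i) (sym bj≡ai))) , l≡i
      where
      k≤q : k ≤ q
      k≤q = between-≤ next≤q j≤q bk

      l≡i : l ≡ i
      l≡i = ≤-antisym (≤-pred l<1+i) i≤l
    ...   | inj₂ refl = ⊥-elim (proj₂ (narrower bk)
                              (at-injective Q (between-≤ next≤q j≤q bk) j′≤q (trans bk≡al (sym bj′≡ai′))))

    conclude : Dec (next ≡ j) → Consecutive j j′
    conclude (yes next≡j) = consecutive-sym (subst (Consecutive j′) next≡j consecutive)
    conclude (no next≢j)  = ⊥-elim (no-closing-edge {Γ = Γ} girth Q̂ P̂ short′ next≤q j≤q (<⇒≤ i<p) i<p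
                                                   next≢j 1+n≢n (inj₁ bj≡ai) only-ends first-edge)

  no-three-consecutive-meetings : ∀ {i} → suc (suc i) ≤ p →
                                  MeetsQ i → MeetsQ (suc i) → MeetsQ (suc (suc i)) → ⊥
  no-three-consecutive-meetings {i} i+1<p (j₀ , j₀≤q , b₀) (j₁ , j₁≤q , b₁) (j₂ , j₂≤q , b₂) =
    <⇒≢ (m<n⇒m<1+n (n<1+n i)) (at-injective P i≤p i+1<p (shared-edge-functional backward back forward forth))
    where
    i<p : i < p
    i<p = <⇒≤ i+1<p
    i≤p : i ≤ p
    i≤p = <⇒≤ i<p

    backward : E (a (suc i)) (a i)
    backward = E-sym (at-step P i<p)

    forward : E (a (suc i)) (a (suc (suc i)))
    forward = at-step P i+1<p

    back : E′ (a (suc i)) (a i)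
    back = subst₂ E′ b₁ b₀ (at-consecutive Q E′-sym j₁≤q j₀≤q
             (consecutive-sym (shared-edge-consecutive i<p j₀≤q j₁≤q b₀ b₁)))

    forth : E′ (a (suc i)) (a (suc (suc i)))
    forth = subst₂ E′ b₁ b₂ (at-consecutive Q E′-sym j₁≤q j₂≤q (shared-edge-consecutive i+1<p j₁≤q j₂≤q b₁ b₂))

  successor-meets : ∀ {k k′} → k < k′ → k′ ≤ p → MeetsQ k → MeetsQ k′ → MeetsQ (suc k)
  successor-meets {k} {k′} k<k′ k′≤p mk mk′ with nearest MeetsQ? (suc k) mk′
  ... | m , mm , 1+k⋯k′ , closest = subst MeetsQ (next-meeting-is-successor k<m m≤p mk mm gap) mm
    where
    k<m : k < m
    k<m = proj₁ (between-ordered k<k′ 1+k⋯k′)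
    m≤p : m ≤ p
    m≤p = ≤-trans (proj₂ (between-ordered k<k′ 1+k⋯k′)) k′≤p
    gap : ∀ {k″} → k < k″ → k″ < m → ¬ MeetsQ k″
    gap k<k″ k″<m mk″ = <-irrefl (closest (inj₁ (k<k″ , <⇒≤ k″<m)) mk″) k″<m

  meetings-consecutive : ∀ {k k′} → k < k′ → k′ ≤ p → MeetsQ k → MeetsQ k′ → k′ ≡ suc k
  meetings-consecutive {k} {k′} k<k′ k′≤p mk mk′ with m≤n⇒m<n∨m≡n k<k′
  ... | inj₂ 1+k≡k′ = sym 1+k≡k′
  ... | inj₁ 1+k<k′ =
    ⊥-elim (no-three-consecutive-meetings (≤-trans 1+k<k′ k′≤p) mk m₁ (successor-meets 1+k<k′ k′≤p m₁ mk′))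
    where
    m₁ : MeetsQ (suc k)
    m₁ = successor-meets k<k′ k′≤p mk mk′

  outside-anticomplete : (∀ {x y} → Common x → Common y → x ≡ y ⊎ Adj Γ x y) → ∃ Common →
                         Anticomplete Γ (λ x → Vert P x × ¬ Common x) (λ y → Vert Q y × ¬ Common y)
  outside-anticomplete clique (_ , (i₀ , i₀≤p , refl) , (j₀ , j₀≤q , b₀))
                       _ _ ((k , k≤p , refl) , x∉) ((l , l≤q , refl) , y∉)
    with nearest MeetsQ? k (j₀ , j₀≤q , b₀) | nearest MeetsP? l (i₀ , i₀≤p , sym b₀)
  ... | i , mi , k⋯i , closest-i | j , mj , l⋯j , closest-j =
    no-closing-edge {Γ = Γ} girth P̂ Q̂ short k≤p i≤p j≤q l≤q k≢i l≢j
      (clique ((i , i≤p , refl) , mi) (mj , (j , j≤q , refl))) only-ends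
    where
    i≤p : i ≤ p
    i≤p = between-≤ k≤p i₀≤p k⋯i
    j≤q : j ≤ q
    j≤q = between-≤ l≤q j₀≤q l⋯j

    k≢i : k ≢ i
    k≢i refl = x∉ ((k , k≤p , refl) , mi)
    l≢j : l ≢ j
    l≢j refl = y∉ (mj , (l , l≤q , refl))

    only-ends : ∀ {k′ l′} → Between k i k′ → Between l j l′ → a k′ ≡ b l′ → k′ ≡ i × l′ ≡ j
    only-ends {k′} {l′} bk bl eq = closest-i bk (l′ , between-≤ l≤q j≤q bl , sym eq) ,
                                   closest-j bl (k′ , between-≤ k≤p i≤p bk , eq)

  lone-meeting-is-endpoint : ∀ {i j} → i ≤ p → j ≤ q → b j ≡ a i → (∀ {k} → k ≤ p → MeetsQ k → k ≡ i) →
                             IsEndpoint P (a i) ⊎ IsEndpoint Q (a i)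
  lone-meeting-is-endpoint {zero}          _   _   _   _    = inj₁ (inj₁ refl)
  lone-meeting-is-endpoint {suc i} {zero}  _   _   b≡a _    = inj₂ (inj₁ b≡a)
  lone-meeting-is-endpoint {suc i} {suc j} i<p j<q b≡a lone with suc i ≟ p | suc j ≟ q
  ... | yes refl | _        = inj₁ (inj₂ refl)
  ... | no _     | yes refl = inj₂ (inj₂ b≡a)
  ... | no 1+i≢p | no 1+j≢q = ⊥-elim (<-irrefl refl (neighbours≤3 {Γ = Γ} cubic distinct adjacent))
    where
    i+1<p : suc i < p
    i+1<p = ≤∧≢⇒< i<p 1+i≢p
    j+1<q : suc j < q
    j+1<q = ≤∧≢⇒< j<q 1+j≢q

    2+m≢m : ∀ {m} → suc (suc m) ≢ m
    2+m≢m {m} eq = <⇒≢ (m<n⇒m<1+n (n<1+n m)) (sym eq)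

    not-on-Q : ∀ {k l} → k ≤ p → l ≤ q → k ≢ suc i → a k ≢ b l
    not-on-Q k≤p l≤q k≢1+i ak≡bl = k≢1+i (lone k≤p (_ , l≤q , sym ak≡bl))

    i≤p : i ≤ p
    i≤p = <⇒≤ (<⇒≤ i+1<p)

    j≤q : j ≤ q
    j≤q = <⇒≤ (<⇒≤ j+1<q)

    neighbours : Vec (Fin n) 4
    neighbours = a i Vec.∷ a (suc (suc i)) Vec.∷ b j Vec.∷ b (suc (suc j)) Vec.∷ Vec.[]

    distinct : VecUnique.Unique neighbours
    distinct =
      (  (2+m≢m ∘ sym ∘ at-injective P i≤p i+1<p)
       ∷ not-on-Q i≤p j≤q (<⇒≢ (n<1+n i))
       ∷ not-on-Q i≤p j+1<q (<⇒≢ (n<1+n i)) ∷ [])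
      ∷ (  not-on-Q i+1<p j≤q 1+n≢n
         ∷ not-on-Q i+1<p j+1<q 1+n≢n ∷ [])
      ∷ (((2+m≢m ∘ sym ∘ at-injective Q j≤q j+1<q) ∷ []) ∷ [] ∷ [])

    adjacent : VecAll.All (Adj Γ (a (suc i))) neighbours
    adjacent =
        Graph.sym Γ (E⇒Γ (at-step P i<p))
      ∷ E⇒Γ (at-step P i+1<p)
      ∷ subst (λ v → Adj Γ v (b j)) b≡a (Graph.sym Γ (E′⇒Γ (at-step Q j<q)))
      ∷ subst (λ v → Adj Γ v (b (suc (suc j)))) b≡a (E′⇒Γ (at-step Q j+1<q))
      ∷ []

  single-meeting : ∀ {i} → i ≤ p → MeetsQ i → (∀ {k} → k ≤ p → MeetsQ k → k ≡ i) →
                   SingleMeeting Γ (Vert P) (Vert Q) (IsEndpoint P) (IsEndpoint Q)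
  single-meeting {i} i≤p mi@(j , j≤q , bj≡ai) lone =
    a i , common⇔ , lone-meeting-is-endpoint i≤p j≤q bj≡ai lone ,
    λ x y (x∈P , x≢u) (y∈Q , y≢u) →
      outside-anticomplete clique (a i , from refl) x y (x∈P , x≢u ∘ to) (y∈Q , y≢u ∘ to)
    where
    common⇔ : ∀ x → Common x ⇔ (x ≡ a i)
    common⇔ x = mk⇔ (λ { ((k , k≤p , refl) , mk) → cong a (lone k≤p mk) })
                    (λ { refl → (i , i≤p , refl) , mi })

    to : ∀ {x} → Common x → x ≡ a i
    to = Equivalence.to (common⇔ _)

    from : ∀ {x} → x ≡ a i → Common x
    from = Equivalence.from (common⇔ _)

    clique : ∀ {x y} → Common x → Common y → x ≡ y ⊎ Adj Γ x y
    clique cx cy = inj₁ (trans (to cx) (sym (to cy)))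

  double-meeting : ∀ {i} → suc i ≤ p → MeetsQ i → MeetsQ (suc i) →
                   (∀ {k} → k ≤ p → MeetsQ k → k ≡ i ⊎ k ≡ suc i) →
                   DoubleMeeting Γ (Vert P) (Vert Q) (HasEdge P) (HasEdge Q)
  double-meeting {i} i<p mi@(j , j≤q , bj≡u) mi′@(j′ , j′≤q , bj′≡v) pair =
    u , v , u≢v , common⇔ , (i , i<p , inj₁ (refl , refl)) ,
    edge-in-Q (shared-edge-consecutive i<p j≤q j′≤q bj≡u bj′≡v) ,
    λ x y (x∈P , x≢u , x≢v) (y∈Q , y≢u , y≢v) →
      outside-anticomplete clique (u , from (inj₁ refl)) x y (x∈P , outside x≢u x≢v) (y∈Q , outside y≢u y≢v)
    where
    u v : Fin n
    u = a i
    v = a (suc i)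

    u≢v : u ≢ v
    u≢v eq = <⇒≢ (n<1+n i) (at-injective P (<⇒≤ i<p) i<p eq)

    common⇔ : ∀ x → Common x ⇔ (x ≡ u ⊎ x ≡ v)
    common⇔ x = mk⇔ (λ { ((k , k≤p , refl) , mk) → Sum.map (cong a) (cong a) (pair k≤p mk) })
                    (λ { (inj₁ refl) → (i , <⇒≤ i<p , refl) , mi
                       ; (inj₂ refl) → (suc i , i<p , refl) , mi′ })

    from : ∀ {x} → x ≡ u ⊎ x ≡ v → Common x
    from = Equivalence.from (common⇔ _)

    outside : ∀ {x} → x ≢ u → x ≢ v → ¬ Common x
    outside x≢u x≢v cx with Equivalence.to (common⇔ _) cx
    ... | inj₁ x≡u = x≢u x≡u
    ... | inj₂ x≡v = x≢v x≡v

    uv : Adj Γ u v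
    uv = E⇒Γ (at-step P i<p)

    clique : ∀ {x y} → Common x → Common y → x ≡ y ⊎ Adj Γ x y
    clique cx cy with Equivalence.to (common⇔ _) cx | Equivalence.to (common⇔ _) cy
    ... | inj₁ refl | inj₁ refl = inj₁ refl
    ... | inj₁ refl | inj₂ refl = inj₂ uv
    ... | inj₂ refl | inj₁ refl = inj₂ (Graph.sym Γ uv)
    ... | inj₂ refl | inj₂ refl = inj₁ refl

    edge-in-Q : Consecutive j j′ → HasEdge Q u v
    edge-in-Q (inj₁ refl) = j , j′≤q , inj₁ (bj≡u , bj′≡v)
    edge-in-Q (inj₂ refl) = j′ , j≤q , inj₂ (bj′≡v , bj≡u)

  meetings-from-first : ∀ {i} → MeetsQ i → (∀ {k} → k < i → ¬ MeetsQ k) →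
                        ∀ {k} → k ≤ p → MeetsQ k → k ≡ i ⊎ k ≡ suc i
  meetings-from-first {i} mi before {k} k≤p mk with m≤n⇒m<n∨m≡n (≮⇒≥ (λ k<i → before k<i mk))
  ... | inj₂ i≡k = inj₁ (sym i≡k)
  ... | inj₁ i<k = inj₂ (meetings-consecutive i<k k≤p mi mk)

  meeting-shape : ∃ Common →
                  MeetingShape Γ (Vert P) (Vert Q) (IsEndpoint P) (IsEndpoint Q) (HasEdge P) (HasEdge Q)
  meeting-shape (_ , (k , k≤p , refl) , mk) with nearest MeetsQ? 0 mk
  ... | i , mi , 0⋯k , closest = conclude (suc i ≤? p ×-dec MeetsQ? (suc i))
    where
    within : ∀ {k′} → k′ ≤ p → MeetsQ k′ → k′ ≡ i ⊎ k′ ≡ suc i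
    within = meetings-from-first mi (λ k′<i mk′ → <-irrefl (closest (inj₁ (z≤n , <⇒≤ k′<i)) mk′) k′<i)

    conclude : Dec (suc i ≤ p × MeetsQ (suc i)) →
               MeetingShape Γ (Vert P) (Vert Q) (IsEndpoint P) (IsEndpoint Q) (HasEdge P) (HasEdge Q)
    conclude (yes (i<p , mi′)) = inj₂ (double-meeting i<p mi mi′ within)
    conclude (no ¬next)        = inj₁ (single-meeting (between-≤ z≤n k≤p 0⋯k) mi lone)
      where
      lone : ∀ {k′} → k′ ≤ p → MeetsQ k′ → k′ ≡ i
      lone k′≤p mk′ with within k′≤p mk′
      ... | inj₁ k′≡i = k′≡i
      ... | inj₂ refl = ⊥-elim (¬next (k′≤p , mk′))

-- The three matchings

module Matchings {n m} {Γ : Graph n} (cubic : Cubic Γ) {ω : Fin (suc m) → Fin n} {M₁ M₂ : ESet n}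
                 (partition : IsPMPartition Γ (CycleEdges ω) M₁ M₂) where

  private
    M : Fin 3 → ESet n
    M = Mat Γ ω M₁ M₂

    GE : Fin 3 → ESet n
    GE = GammaE Γ ω M₁ M₂

    perfect₁ : IsPerfectMatching Γ M₁
    perfect₁ = proj₁ partition

    perfect₂ : IsPerfectMatching Γ M₂
    perfect₂ = proj₁ (proj₂ partition)

    cycle⇔ : ∀ u v → CycleEdges ω u v ⇔ (M₁ u v ⊎ M₂ u v)
    cycle⇔ = proj₁ (proj₂ (proj₂ partition))

    M₁∩M₂ : ∀ u v → ¬ (M₁ u v × M₂ u v)
    M₁∩M₂ = proj₂ (proj₂ (proj₂ partition))

    on-cycle : ∀ {u v} → M₁ u v ⊎ M₂ u v → CycleEdges ω u v
    on-cycle = Equivalence.from (cycle⇔ _ _)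

  CycleEdges-sym : Symmetric (CycleEdges ω)
  CycleEdges-sym (i , inj₁ e) = i , inj₂ e
  CycleEdges-sym (i , inj₂ e) = i , inj₁ e

  M⇒Γ : ∀ k → M k ⇒ Adj Γ
  M⇒Γ zero             = proj₁ perfect₁ _ _
  M⇒Γ (suc zero)       = proj₁ perfect₂ _ _
  M⇒Γ (suc (suc zero)) = proj₁

  M-sym : ∀ k → Symmetric (M k)
  M-sym zero             = proj₁ (proj₂ perfect₁)
  M-sym (suc zero)       = proj₁ (proj₂ perfect₂)
  M-sym (suc (suc zero)) (xy , ¬cycle) = Graph.sym Γ xy , ¬cycle ∘ CycleEdges-sym

  M-disjoint : ∀ {k k′} → k ≢ k′ → ∀ {x y} → M k x y → ¬ M k′ x y
  M-disjoint {zero}           {zero}           k≢k′ = ⊥-elim (k≢k′ refl)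
  M-disjoint {suc zero}       {suc zero}       k≢k′ = ⊥-elim (k≢k′ refl)
  M-disjoint {suc (suc zero)} {suc (suc zero)} k≢k′ = ⊥-elim (k≢k′ refl)
  M-disjoint {zero}           {suc zero}       _ m₁ m₂ = M₁∩M₂ _ _ (m₁ , m₂)
  M-disjoint {suc zero}       {zero}           _ m₂ m₁ = M₁∩M₂ _ _ (m₁ , m₂)
  M-disjoint {zero}           {suc (suc zero)} _ m₁ (_ , ¬cycle) = ¬cycle (on-cycle (inj₁ m₁))
  M-disjoint {suc zero}       {suc (suc zero)} _ m₂ (_ , ¬cycle) = ¬cycle (on-cycle (inj₂ m₂))
  M-disjoint {suc (suc zero)} {zero}           _ (_ , ¬cycle) m₁ = ¬cycle (on-cycle (inj₁ m₁))
  M-disjoint {suc (suc zero)} {suc zero}       _ (_ , ¬cycle) m₂ = ¬cycle (on-cycle (inj₂ m₂))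

  -- Every vertex has an M₃-partner only because Γ is cubic; constructively this holds up to double negation.
  M-partner : ∀ k x → ¬ ¬ ∃ (M k x)
  M-partner zero       x none = let (u , xu , _) = proj₂ (proj₂ perfect₁) x in none (u , xu)
  M-partner (suc zero) x none = let (u , xu , _) = proj₂ (proj₂ perfect₂) x in none (u , xu)
  M-partner (suc (suc zero)) x none with cubic x | proj₂ (proj₂ perfect₁) x | proj₂ (proj₂ perfect₂) x
  ... | a , b , c , a≢b , a≢c , b≢c , xa , xb , xc , _ | u₁ , _ , only₁ | u₂ , _ , only₂ =
    one-of-partners xa λ a∈ → one-of-partners xb λ b∈ → one-of-partners xc λ c∈ →
      <-irrefl refl (pigeonhole-⊆ ((a≢b ∷ a≢c ∷ []) ∷ (b≢c ∷ []) ∷ [] ∷ []) (a∈ ∷ b∈ ∷ c∈ ∷ []))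
    where
    one-of-partners : ∀ {w} → Adj Γ x w → ¬ ¬ (w ∈ₗ u₁ ∷ u₂ ∷ [])
    one-of-partners {w} xw w∉ = none (w , xw , λ cycle → w∉ (matched (Equivalence.to (cycle⇔ x w) cycle)))
      where
      matched : M₁ x w ⊎ M₂ x w → w ∈ₗ u₁ ∷ u₂ ∷ []
      matched (inj₁ m₁) = here (only₁ w m₁)
      matched (inj₂ m₂) = there (here (only₂ w m₂))

  GammaE-sym : ∀ k → Symmetric (GE k)
  GammaE-sym k (xy , ¬M) = Graph.sym Γ xy , ¬M ∘ M-sym k

  -- Otherwise y, z and the Mᵢ- and Mⱼ-partners of x would be four distinct neighbours of x.
  GammaE-shared-functional : ∀ {i j} → i ≢ j → ∀ {x y z} → GE i x y → GE j x y → GE i x z → GE j x z → y ≡ z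
  GammaE-shared-functional {i} {j} i≢j {x} {y} {z} (xy , ¬Mᵢy) (_ , ¬Mⱼy) (xz , ¬Mᵢz) (_ , ¬Mⱼz) =
    decidable-stable (y F.≟ z) λ y≢z →
      M-partner i x λ (uᵢ , Mᵢu) → M-partner j x λ (uⱼ , Mⱼu) →
        <-irrefl refl (neighbours≤3 {Γ = Γ} cubic
          ((y≢z ∷ avoids ¬Mᵢy Mᵢu ∷ avoids ¬Mⱼy Mⱼu ∷ []) ∷
           (avoids ¬Mᵢz Mᵢu ∷ avoids ¬Mⱼz Mⱼu ∷ []) ∷
           ((λ { refl → M-disjoint i≢j Mᵢu Mⱼu }) ∷ []) ∷ [] ∷ [])
          (xy ∷ xz ∷ M⇒Γ i Mᵢu ∷ M⇒Γ j Mⱼu ∷ []))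
    where
    avoids : ∀ {k w u} → ¬ M k x w → M k x u → w ≢ u
    avoids ¬Mw Mu refl = ¬Mw Mu

  component-edge⇒Γ : ∀ {k T} → CompEdges (GE k) T ⇒ Adj Γ
  component-edge⇒Γ ((xy , _) , _) = xy

  component-edge-sym : ∀ k {T} → Symmetric (CompEdges (GE k) T)
  component-edge-sym k (e , xT , yT) = GammaE-sym k e , yT , xT

  component-edges-shared-functional :
    ∀ {i j T T′} → i ≢ j → ∀ {x y z} → CompEdges (GE i) T x y → CompEdges (GE j) T′ x y →
    CompEdges (GE i) T x z → CompEdges (GE j) T′ x z → y ≡ z
  component-edges-shared-functional i≢j (ey , _) (ey′ , _) (ez , _) (ez′ , _) =
    GammaE-shared-functional i≢j ey ey′ ez ez′

component-⊆ : ∀ {n} {H : ESet n} {T T′ : VSet n} → IsComponent H T → IsComponent H T′ →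
              ∀ {x} → x ∈ T → x ∈ T′ → ∀ {v} → v ∈ T → v ∈ T′
component-⊆ {H = H} {T} {T′} (_ , connected , _) (_ , _ , closed′) {x} xT xT′ {v} vT =
  along (connected x v xT vT) xT′
  where
  along : ∀ {y w} → Star (λ a b → H a b × a ∈ T × b ∈ T) y w → y ∈ T′ → w ∈ T′
  along ε                   yT′ = yT′
  along ((h , _ , _) ◅ rest) yT′ = along rest (closed′ _ _ yT′ h)

components-sharing-vertex : ∀ {n} {H : ESet n} {S S′ : VSet n} → IsComponent H S → IsComponent H S′ →
                            ∀ {x} → x ∈ S → x ∈ S′ → SameSubgraph S (CompEdges H S) S′ (CompEdges H S′)
components-sharing-vertex {S = S} {S′} K K′ xS xS′ =
  (S⊆S′ , S′⊆S) ,
  λ _ _ → mk⇔ (λ (h , uS , vS) → h , S⊆S′ uS , S⊆S′ vS) (λ (h , uS′ , vS′) → h , S′⊆S uS′ , S′⊆S vS′)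
  where
  S⊆S′ : ∀ {v} → v ∈ S → v ∈ S′
  S⊆S′ = component-⊆ K K′ xS xS′

  S′⊆S : ∀ {v} → v ∈ S′ → v ∈ S
  S′⊆S = component-⊆ K′ K xS′ xS

short-enough : ∀ {t e p q} → 3 ≤ t → p < t ^ e → q < t ^ e → suc p + suc q < t ^ suc e
short-enough {t@(suc _)} {e} {p} {q} 3≤t p<T q<T = begin-strict
  suc p + suc q    ≤⟨ +-mono-≤ p<T q<T ⟩
  t ^ e + t ^ e    ≡⟨ cong (t ^ e +_) (sym (+-identityʳ (t ^ e))) ⟩
  2 * t ^ e        <⟨ *-monoˡ-< (t ^ e) {{m^n≢0 t e}} 3≤t ⟩
  t * t ^ e        ∎
  where open ≤-Reasoning

module _ {n} {S : VSet n} {E : ESet n} (L : PathIn S E) where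

  private
    index : ℕ → Fin (suc (len L))
    index k = k mod suc (len L)

    index-of : ∀ {k} (i : Fin (suc (len L))) → toℕ i ≡ k → index k ≡ i
    index-of i refl = toℕ-injective (trans (toℕ-fromℕ< _) (m≤n⇒m%n≡m (toℕ≤pred[n] i)))

    toℕ-index : ∀ {k} → k ≤ len L → toℕ (index k) ≡ k
    toℕ-index k≤ = trans (toℕ-fromℕ< _) (m≤n⇒m%n≡m k≤)

    lower : ∀ {k} (k< : k < len L) → vtx L (index k) ≡ vtx L (inject₁ (fromℕ< k<))
    lower k< = cong (vtx L) (index-of _ (trans (toℕ-inject₁ _) (toℕ-fromℕ< k<)))

    upper : ∀ {k} (k< : k < len L) → vtx L (index (suc k)) ≡ vtx L (suc (fromℕ< k<))
    upper k< = cong (vtx L) (index-of _ (cong suc (toℕ-fromℕ< k<)))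

  toPath : Path E
  toPath = record
    { last         = len L
    ; at           = vtx L ∘ index
    ; at-injective = λ k≤ l≤ eq → trans (sym (toℕ-index k≤)) (trans (cong toℕ (inj L eq)) (toℕ-index l≤))
    ; at-step      = λ k< → subst₂ E (sym (lower k<)) (sym (upper k<)) (edges L (fromℕ< k<))
    }

  VP⊆S : ∀ {x} → VP L x → x ∈ S
  VP⊆S (k , refl) = inS L k

  Vert-toPath : ∀ x → Vert toPath x ⇔ VP L x
  Vert-toPath x = mk⇔ (λ (k , _ , eq) → index k , eq)
                      (λ (i , eq) → toℕ i , toℕ≤pred[n] i , trans (cong (vtx L) (index-of i refl)) eq)

  IsEndpoint-toPath : ∀ {u} → IsEndpoint toPath u → IsEnd L u
  IsEndpoint-toPath (inj₁ eq) = inj₁ (trans (cong (vtx L) (sym (index-of zero refl))) eq)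
  IsEndpoint-toPath (inj₂ eq) = inj₂ (trans (cong (vtx L) (sym (index-of (fromℕ (len L)) (toℕ-fromℕ _)))) eq)

  HasEdge-toPath : ∀ {u v} → HasEdge toPath u v → AdjIn L u v
  HasEdge-toPath (k , k< , inj₁ (eq , eq′)) =
    fromℕ< k< , inj₁ (trans (sym (lower k<)) eq , trans (sym (upper k<)) eq′)
  HasEdge-toPath (k , k< , inj₂ (eq , eq′)) =
    fromℕ< k< , inj₂ (trans (sym (lower k<)) eq , trans (sym (upper k<)) eq′)

lemma4p3 : (t : ℕ) → 5 ≤ t →
    (n : ℕ) (Γ : Graph n) → Cubic Γ → GirthAtLeast Γ (t ^ (5 * t)) →
    (m : ℕ) (ω : Fin (suc m) → Fin n) → IsHamiltonianCycle Γ m ω →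
    (M₁ M₂ : ESet n) → IsPMPartition Γ (CycleEdges ω) M₁ M₂ →
    (i j : Fin 3) (S S′ : VSet n) →
    IsComponent (GammaE Γ ω M₁ M₂ i) S →
    IsComponent (GammaE Γ ω M₁ M₂ j) S′ →
    ¬ SameSubgraph S (CompEdges (GammaE Γ ω M₁ M₂ i) S) S′ (CompEdges (GammaE Γ ω M₁ M₂ j) S′) →
    (L : PathIn S (CompEdges (GammaE Γ ω M₁ M₂ i) S)) →
    (L′ : PathIn S′ (CompEdges (GammaE Γ ω M₁ M₂ j) S′)) →
    len L < t ^ (5 * t ∸ 1) → len L′ < t ^ (5 * t ∸ 1) →
    (∃[ x ] (x ∈ VP L × x ∈ VP L′)) →
    (∃[ u ] ((∀ x → (x ∈ VP L × x ∈ VP L′) ⇔ (x ≡ u)) ×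
             (IsEnd L u ⊎ IsEnd L′ u) ×
             Anticomplete Γ (λ x → x ∈ VP L × x ≢ u) (λ x → x ∈ VP L′ × x ≢ u)))
    ⊎
    (∃[ u ] ∃[ v ] (u ≢ v ×
             (∀ x → (x ∈ VP L × x ∈ VP L′) ⇔ (x ≡ u ⊎ x ≡ v)) ×
             AdjIn L u v × AdjIn L′ u v ×
             Anticomplete Γ (λ x → x ∈ VP L × x ≢ u × x ≢ v)
                            (λ x → x ∈ VP L′ × x ≢ u × x ≢ v)))
lemma4p3 t 5≤t@(s≤s _) n Γ cubic girth m ω _ M₁ M₂ partition i j S S′ K K′ K≢K′ L L′ L-short L′-short
         (x , x∈L , x∈L′) with i F.≟ j
... | yes refl = ⊥-elim (K≢K′ (components-sharing-vertex K K′ (VP⊆S L x∈L) (VP⊆S L′ x∈L′)))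
... | no i≢j =
  MeetingShape-transport {Γ = Γ} (Vert-toPath L) (Vert-toPath L′)
    (IsEndpoint-toPath L) (IsEndpoint-toPath L′) (HasEdge-toPath L) (HasEdge-toPath L′)
    (meeting-shape (x , Equivalence.from (Vert-toPath L x) x∈L , Equivalence.from (Vert-toPath L′ x) x∈L′))
  where
  -- Matching 5≤t made t a successor, so suc (5 * t ∸ 1) reduces to 5 * t.
  short : suc (len L) + suc (len L′) < t ^ (5 * t)
  short = short-enough {e = 5 * t ∸ 1} (≤-trans (s≤s (s≤s (s≤s z≤n))) 5≤t) L-short L′-short

  open Matchings cubic partition
  open Meetings {Γ = Γ} cubic girth component-edge⇒Γ component-edge⇒Γ
                (component-edge-sym i) (component-edge-sym j) (component-edges-shared-functional i≢j)
                (toPath L) (toPath L′) short
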